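{- Let $\mathbf{b}=(b_1,\dots,b_d)\in\mathbb{Z}_{>0}^d$ with $\sum_{i=1}^d b_i=2\beta$ even, let $P_{\mathbf{b}}$ and the notation $(S,k)$ be as in the context, let $\varepsilon=\frac{1}{5\beta}$ and $\mathbf{c}=\mathbf{e}_{[d+1]}+\varepsilon\mathbf{e}_{d+2}\in\mathbb{R}^{d+2}$. Then: (1) the vertex $([d+1],d+2)$ is the unique maximizer of $\mathbf{c}^\intercal\mathbf{x}$ over $P_{\mathbf{b}}$; (2) if $S\subsetneq T\subseteq[d+1]$ and $(S,d+2)$, $(T,d+2)$ are vertices of $P_{\mathbf{b}}$, then $\mathbf{c}^\intercal(S,d+2)<\mathbf{c}^\intercal(T,d+2)$.
   Context: $\mathbf{w}=(b_1,\dots,b_d,-\beta,\beta+\frac12)\in\mathbb{R}^{d+2}$ and $P_{\mathbf{b}}=[0,1]^{d+2}\cap\{\mathbf{x}\in\mathbb{R}^{d+2}:\mathbf{w}^\intercal\mathbf{x}\le\beta+\frac14\}$. For $S\subseteq[d+2]$ let $\mathbf{e}_S=\sum_{i\in S}\mathbf{e}_i$, and for $k\in[d+2]\setminus S$ let $(S,k)$ denote the point $\mathbf{e}_S+\frac{\beta+\frac14-\sum_{i\in S}w_i}{w_k}\mathbf{e}_k$.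
   Formalization: The polytope $P_{\mathbf{b}}$ consists only of its points with rational coordinates rather than points of $\mathbb{R}^{d+2}$, so vertices, the maximum of $\mathbf{c}^\intercal\mathbf{x}$ and its uniqueness refer to these points. -}

module Defs where

open import Data.Nat as ℕ using (ℕ; zero; suc; NonZero)
open import Data.Integer using (+_; -[1+_])
open import Data.Rational using (ℚ; _+_; _*_; _-_; _/_; _≤_; _<_; 0ℚ; 1ℚ; -_)
open import Data.Fin using (Fin; zero; suc; splitAt; _↑ʳ_)
open import Data.Fin.Subset using (Subset; inside; outside; _∈_)
open import Data.Fin.Subset.Properties using (_∈?_)
open import Data.Sum using (inj₁; inj₂)
open import Data.Product using (_×_)
open import Data.Vec using (tabulate)
open import Relation.Nullary using (yes; no)
open import Relation.Binary.PropositionalEquality using (_≡_)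

-- Conventions: coordinates 1..d+2 of R^{d+2} are the indices 0..d+1 of Fin (d + 2).
-- Points are functions Fin (d + 2) → ℚ (coordinates over the rationals).

Vecℚ : ℕ → Set
Vecℚ n = Fin n → ℚ

ℕtoℚ : ℕ → ℚ
ℕtoℚ n = + n / 1

sumℕ : ∀ {n} → (Fin n → ℕ) → ℕ
sumℕ {zero}  f = 0
sumℕ {suc n} f = f zero ℕ.+ sumℕ (λ i → f (suc i))

dot : ∀ {n} → Vecℚ n → Vecℚ n → ℚ
dot {zero}  x y = 0ℚ
dot {suc n} x y = x zero * y zero + dot (λ i → x (suc i)) (λ i → y (suc i))

lastIx : (d : ℕ) → Fin (d ℕ.+ 2)
lastIx d = d ↑ʳ suc zero

wvec : (d : ℕ) → (Fin d → ℕ) → ℕ → Vecℚ (d ℕ.+ 2)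
wvec d b β i with splitAt d i
... | inj₁ j = ℕtoℚ (b j)
... | inj₂ zero = - ℕtoℚ β
... | inj₂ (suc zero) = ℕtoℚ β + (+ 1 / 2)

rhs : ℕ → ℚ
rhs β = ℕtoℚ β + (+ 1 / 4)

InP : (d : ℕ) → (Fin d → ℕ) → ℕ → Vecℚ (d ℕ.+ 2) → Set
InP d b β x = (∀ i → 0ℚ ≤ x i × x i ≤ 1ℚ) × dot (wvec d b β) x ≤ rhs β

IsVertex : (d : ℕ) → (Fin d → ℕ) → ℕ → Vecℚ (d ℕ.+ 2) → Set
IsVertex d b β x =
  InP d b β x ×
  (∀ (y z : Vecℚ (d ℕ.+ 2)) (t : ℚ) → InP d b β y → InP d b β z →
     0ℚ < t → t < 1ℚ → (∀ i → x i ≡ t * y i + (1ℚ - t) * z i) → ∀ i → y i ≡ z i)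

eS : ∀ {n} → Subset n → Vecℚ n
eS S i with i ∈? S
... | yes _ = 1ℚ
... | no _  = 0ℚ

eIx : ∀ {n} → Fin n → Vecℚ n
eIx k i with k Data.Fin.≟ i
... | yes _ = 1ℚ
... | no _  = 0ℚ

-- 1 / w_{d+2} = 1 / (β + 1/2) = 2 / (2β + 1)
invWlast : ℕ → ℚ
invWlast β = + 2 / suc (2 ℕ.* β)

-- the point (S, d+2) = e_S + ((β + 1/4 - Σ_{i∈S} w_i) / w_{d+2}) e_{d+2}
ptS : (d : ℕ) → (Fin d → ℕ) → ℕ → Subset (d ℕ.+ 2) → Vecℚ (d ℕ.+ 2)
ptS d b β S i =
  eS S i + ((rhs β - dot (wvec d b β) (eS S)) * invWlast β) * eIx (lastIx d) i

upToD1 : (d : ℕ) → Subset (d ℕ.+ 2)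
upToD1 d = tabulate f
  where
  f : Fin (d ℕ.+ 2) → Data.Fin.Subset.Side
  f i with splitAt d i
  ... | inj₁ _ = inside
  ... | inj₂ zero = inside
  ... | inj₂ (suc zero) = outside

eps : (β : ℕ) → .{{NonZero β}} → ℚ
eps (suc k) = + 1 / (5 ℕ.* suc k)

cvec : (d β : ℕ) → .{{NonZero β}} → Vecℚ (d ℕ.+ 2)
cvec d β i = eS (upToD1 d) i + eps β * eIx (lastIx d) i

module Submission where

-- Put κ = ε / w_{d+2} and a = c - κ w. Then a_{d+2} = 0, a_{d+1} = 1 + κβ, and a_j = 1 - κ b_j ≥ 1 - 2βκ > 0
-- for j ≤ d; this is the only place where the size of ε = 1/(5β) matters. For x ∈ P_b,
--   c·x = a·x + κ w·x ≤ Σ_{i ≤ d+1} a_i + κ (β + 1/4),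
-- with equality iff x_i = 1 for every i ≤ d+1 and w·x = β + 1/4, i.e. iff x = ([d+1], d+2); a unique
-- maximiser of a linear functional is an extreme point. Every point (S, d+2) lies on the hyperplane
-- w·x = β + 1/4, so c·(S, d+2) = a·e_S + κ (β + 1/4), which grows strictly with S as long as d+2 ∉ S.

open import Defs
open import Data.Nat as ℕ using (ℕ; zero; suc)
open import Data.Fin using (Fin; zero; suc)
open import Relation.Binary.PropositionalEquality

module Arithmetic where
  import Data.Nat.Properties as ℕ
  open import Data.Nat.Coprimality using (1-coprimeTo) renaming (sym to coprime-sym)
  open import Data.Integer as ℤ using (+_)
  import Data.Integer.Properties as ℤ
  open import Data.Rational
  open import Data.Rational.Properties
  import Data.Rational.Unnormalised as ℚᵘ
  import Data.Rational.Unnormalised.Properties as ℚᵘ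
  open import Data.Rational.Solver
  open +-*-Solver using (solve; _:+_; _:-_; _:=_)
  open import Data.Product using (_×_; _,_)
  open import Data.Empty using (⊥-elim)
  open import Function using (_∘_)
  open import Relation.Binary.Definitions using (tri<; tri≈; tri>)

  ℕtoℚ≡mkℚ : ∀ n → ℕtoℚ n ≡ mkℚ (+ n) 0 (coprime-sym (1-coprimeTo n))
  ℕtoℚ≡mkℚ n = normalize-coprime (coprime-sym (1-coprimeTo n))

  ℕtoℚ-homo-+ : ∀ m n → ℕtoℚ (m ℕ.+ n) ≡ ℕtoℚ m + ℕtoℚ n
  ℕtoℚ-homo-+ m n = begin
    + (m ℕ.+ n) / 1                  ≡⟨ /-cong (sym (cong₂ ℤ._+_ (ℤ.*-identityʳ (+ m)) (ℤ.*-identityʳ (+ n)))) refl ⟩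
    (+ m ℤ.* + 1 ℤ.+ + n ℤ.* + 1) / 1 ≡⟨ cong₂ _+_ (ℕtoℚ≡mkℚ m) (ℕtoℚ≡mkℚ n) ⟨
    ℕtoℚ m + ℕtoℚ n                  ∎
    where open ≡-Reasoning

  ℕtoℚ-homo-* : ∀ m n → ℕtoℚ (m ℕ.* n) ≡ ℕtoℚ m * ℕtoℚ n
  ℕtoℚ-homo-* m n = begin
    + (m ℕ.* n) / 1   ≡⟨ /-cong (ℤ.pos-* m n) refl ⟩
    (+ m ℤ.* + n) / 1 ≡⟨ cong₂ _*_ (ℕtoℚ≡mkℚ m) (ℕtoℚ≡mkℚ n) ⟨
    ℕtoℚ m * ℕtoℚ n   ∎
    where open ≡-Reasoning

  ℕtoℚ-mono-≤ : ∀ {m n} → m ℕ.≤ n → ℕtoℚ m ≤ ℕtoℚ n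
  ℕtoℚ-mono-≤ {m} {n} m≤n = subst₂ _≤_ (sym (ℕtoℚ≡mkℚ m)) (sym (ℕtoℚ≡mkℚ n))
    (*≤* (subst₂ ℤ._≤_ (sym (ℤ.*-identityʳ (+ m))) (sym (ℤ.*-identityʳ (+ n))) (ℤ.+≤+ m≤n)))

  ℕtoℚ-nonNeg : ∀ n → 0ℚ ≤ ℕtoℚ n
  ℕtoℚ-nonNeg n = ℕtoℚ-mono-≤ {0} {n} ℕ.z≤n

  p/n*n≡p : ∀ p n .{{_ : ℕ.NonZero n}} → (+ p / n) * ℕtoℚ n ≡ ℕtoℚ p
  p/n*n≡p p n@(suc m) = toℚᵘ-injective (begin-equality
    toℚᵘ ((+ p / n) * ℕtoℚ n)
      ≃⟨ toℚᵘ-homo-* (+ p / n) (ℕtoℚ n) ⟩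
    toℚᵘ (+ p / n) ℚᵘ.* toℚᵘ (ℕtoℚ n)
      ≃⟨ ℚᵘ.*-cong (toℚᵘ-fromℚᵘ (ℚᵘ.mkℚᵘ (+ p) m)) (toℚᵘ-fromℚᵘ (ℚᵘ.mkℚᵘ (+ n) 0)) ⟩
    ℚᵘ.mkℚᵘ (+ p) m ℚᵘ.* ℚᵘ.mkℚᵘ (+ n) 0
      ≃⟨ ℚᵘ.*≡* (trans (ℤ.*-identityʳ (+ p ℤ.* + n)) (cong (λ j → + p ℤ.* + j) (sym (ℕ.*-identityʳ n)))) ⟩
    ℚᵘ.mkℚᵘ (+ p) 0
      ≃⟨ toℚᵘ-fromℚᵘ (ℚᵘ.mkℚᵘ (+ p) 0) ⟨
    toℚᵘ (ℕtoℚ p) ∎)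
    where open ℚᵘ.≤-Reasoning

  ≤-sumℕ : ∀ {n} (f : Fin n → ℕ) i → f i ℕ.≤ sumℕ f
  ≤-sumℕ f zero = ℕ.m≤m+n (f zero) (sumℕ (f ∘ suc))
  ≤-sumℕ f (suc i) = ℕ.≤-trans (≤-sumℕ (f ∘ suc) i) (ℕ.m≤n+m (sumℕ (f ∘ suc)) (f zero))

  *-cancelˡ-≡-pos : ∀ {r p q} → 0ℚ < r → r * p ≡ r * q → p ≡ q
  *-cancelˡ-≡-pos {r} 0<r eq = ≤-antisym (cancel (≤-reflexive eq)) (cancel (≤-reflexive (sym eq)))
    where
    cancel : ∀ {p q} → r * p ≤ r * q → p ≤ q
    cancel = *-cancelˡ-≤-pos r {{positive 0<r}}

  p<q⇒0<q-p : ∀ {p q} → p < q → 0ℚ < q - p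
  p<q⇒0<q-p {p} {q} p<q = subst (_< q - p) (+-inverseʳ p) (+-monoˡ-< (- p) p<q)

  +-mono-≤-tight : ∀ {p q r s} → p ≤ q → r ≤ s → p + r ≡ q + s → p ≡ q × r ≡ s
  +-mono-≤-tight {p} {q} {r} {s} p≤q r≤s eq with <-cmp p q
  ... | tri< p<q _ _ = ⊥-elim (<-irrefl eq (+-mono-<-≤ p<q r≤s))
  ... | tri> _ _ p>q = ⊥-elim (<-irrefl refl (<-≤-trans p>q p≤q))
  ... | tri≈ _ refl _ = refl , (begin
    r         ≡⟨ solve 2 (λ p r → r := p :+ r :- p) refl p r ⟩
    p + r - p ≡⟨ cong (_- p) eq ⟩
    p + s - p ≡⟨ solve 2 (λ p s → p :+ s :- p := s) refl p s ⟩
    s         ∎)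
    where open ≡-Reasoning

module DotProduct where
  open Arithmetic
  open import Data.Fin as Fin using (_↑ˡ_; _↑ʳ_)
  open import Data.Fin.Subset using (Subset; _∈_; _∉_; _⊂_)
  open import Data.Fin.Subset.Properties using (_∈?_)
  open import Data.Vec.Functional using (head; tail)
  open import Data.Rational
  open import Data.Rational.Properties
  open import Data.Rational.Solver
  open +-*-Solver using (solve; _:+_; _:*_; _:-_; _:=_; con)
  open import Data.Product using (_,_)
  open import Function using (_∘_)
  open import Relation.Nullary using (yes; no; contradiction)

  private variable
    n : ℕ

  eIx-diag : (k : Fin n) → eIx k k ≡ 1ℚ
  eIx-diag k with k Fin.≟ k
  ... | yes _ = refl
  ... | no k≢k = contradiction refl k≢k

  eIx-offDiag : (k i : Fin n) → k ≢ i → eIx k i ≡ 0ℚ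
  eIx-offDiag k i k≢i with k Fin.≟ i
  ... | yes k≡i = contradiction k≡i k≢i
  ... | no _ = refl

  eIx-suc : (k i : Fin n) → eIx (suc k) (suc i) ≡ eIx k i
  eIx-suc k i with k Fin.≟ i
  ... | yes _ = refl
  ... | no _ = refl

  dot-congˡ : {w w′ : Vecℚ n} (x : Vecℚ n) → (∀ i → w i ≡ w′ i) → dot w x ≡ dot w′ x
  dot-congˡ {zero} x eq = refl
  dot-congˡ {suc n} x eq = cong₂ _+_ (cong (_* head x) (eq zero)) (dot-congˡ (tail x) (eq ∘ suc))

  dot-congʳ : (w : Vecℚ n) {x x′ : Vecℚ n} → (∀ i → x i ≡ x′ i) → dot w x ≡ dot w x′
  dot-congʳ {zero} w eq = refl
  dot-congʳ {suc n} w eq = cong₂ _+_ (cong (head w *_) (eq zero)) (dot-congʳ (tail w) (eq ∘ suc))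

  dot-zeroʳ : (w : Vecℚ n) → dot w (λ _ → 0ℚ) ≡ 0ℚ
  dot-zeroʳ {zero} w = refl
  dot-zeroʳ {suc n} w = cong₂ _+_ (*-zeroʳ (head w)) (dot-zeroʳ (tail w))

  dot-distribˡ-+ : (w x y : Vecℚ n) → dot w (λ i → x i + y i) ≡ dot w x + dot w y
  dot-distribˡ-+ {zero} w x y = refl
  dot-distribˡ-+ {suc n} w x y = begin
    head w * (head x + head y) + dot (tail w) (λ i → tail x i + tail y i)
      ≡⟨ cong (head w * (head x + head y) +_) (dot-distribˡ-+ (tail w) (tail x) (tail y)) ⟩
    head w * (head x + head y) + (dot (tail w) (tail x) + dot (tail w) (tail y))
      ≡⟨ solve 5 (λ a b c d e → a :* (b :+ c) :+ (d :+ e) := a :* b :+ d :+ (a :* c :+ e))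
               refl (head w) (head x) (head y) (dot (tail w) (tail x)) (dot (tail w) (tail y)) ⟩
    dot w x + dot w y ∎
    where open ≡-Reasoning

  dot-*ʳ : (w x : Vecℚ n) (t : ℚ) → dot w (λ i → t * x i) ≡ t * dot w x
  dot-*ʳ {zero} w x t = sym (*-zeroʳ t)
  dot-*ʳ {suc n} w x t = begin
    head w * (t * head x) + dot (tail w) (λ i → t * tail x i)
      ≡⟨ cong (head w * (t * head x) +_) (dot-*ʳ (tail w) (tail x) t) ⟩
    head w * (t * head x) + t * dot (tail w) (tail x)
      ≡⟨ solve 4 (λ a b t d → a :* (t :* b) :+ t :* d := t :* (a :* b :+ d))
               refl (head w) (head x) t (dot (tail w) (tail x)) ⟩
    t * dot w x ∎
    where open ≡-Reasoning

  dot-decompose : (c w x : Vecℚ n) (t : ℚ) → dot c x ≡ dot (λ i → c i - t * w i) x + t * dot w x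
  dot-decompose {zero} c w x t = sym (trans (+-identityˡ _) (*-zeroʳ t))
  dot-decompose {suc n} c w x t = begin
    head c * head x + dot (tail c) (tail x)
      ≡⟨ cong (head c * head x +_) (dot-decompose (tail c) (tail w) (tail x) t) ⟩
    head c * head x + (dot (λ i → tail c i - t * tail w i) (tail x) + t * dot (tail w) (tail x))
      ≡⟨ solve 6 (λ c x w t a d → c :* x :+ (a :+ t :* d) := (c :- t :* w) :* x :+ a :+ t :* (w :* x :+ d))
               refl (head c) (head x) (head w) t (dot (λ i → tail c i - t * tail w i) (tail x)) (dot (tail w) (tail x)) ⟩
    dot (λ i → c i - t * w i) x + t * dot w x ∎
    where open ≡-Reasoning

  dot-eIxʳ : (w : Vecℚ n) (k : Fin n) → dot w (eIx k) ≡ w k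
  dot-eIxʳ {suc n} w zero = begin
    head w * eIx {suc n} zero zero + dot (tail w) (tail (eIx zero))
      ≡⟨ cong₂ (λ e s → head w * e + s) (eIx-diag {suc n} zero)
               (trans (dot-congʳ (tail w) (λ i → eIx-offDiag zero (suc i) λ ())) (dot-zeroʳ (tail w))) ⟩
    head w * 1ℚ + 0ℚ
      ≡⟨ trans (+-identityʳ _) (*-identityʳ _) ⟩
    head w ∎
    where open ≡-Reasoning
  dot-eIxʳ {suc n} w (suc k) = begin
    head w * eIx (suc k) zero + dot (tail w) (tail (eIx (suc k)))
      ≡⟨ cong₂ (λ e s → head w * e + s) (eIx-offDiag (suc k) zero λ ())
               (trans (dot-congʳ (tail w) (eIx-suc k)) (dot-eIxʳ (tail w) k)) ⟩
    head w * 0ℚ + w (suc k)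
      ≡⟨ trans (cong (_+ w (suc k)) (*-zeroʳ (head w))) (+-identityˡ _) ⟩
    w (suc k) ∎
    where open ≡-Reasoning

  dot-+-*eIx : (u x : Vecℚ n) (t : ℚ) (k : Fin n) → dot u (λ i → x i + t * eIx k i) ≡ dot u x + t * u k
  dot-+-*eIx u x t k = begin
    dot u (λ i → x i + t * eIx k i)      ≡⟨ dot-distribˡ-+ u x (λ i → t * eIx k i) ⟩
    dot u x + dot u (λ i → t * eIx k i)  ≡⟨ cong (dot u x +_) (dot-*ʳ u (eIx k) t) ⟩
    dot u x + t * dot u (eIx k)         ≡⟨ cong (λ s → dot u x + t * s) (dot-eIxʳ u k) ⟩
    dot u x + t * u k                   ∎
    where open ≡-Reasoning

  dot-++ : ∀ m {n} (x y : Vecℚ (m ℕ.+ n)) →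
    dot x y ≡ dot (λ i → x (i ↑ˡ n)) (λ i → y (i ↑ˡ n)) + dot (λ i → x (m ↑ʳ i)) (λ i → y (m ↑ʳ i))
  dot-++ zero x y = sym (+-identityˡ (dot x y))
  dot-++ (suc m) {n} x y = trans (cong (head x * head y +_) (dot-++ m (tail x) (tail y)))
    (sym (+-assoc (head x * head y) (dot (λ i → tail x (i ↑ˡ n)) (λ i → tail y (i ↑ˡ n)))
                  (dot (λ i → tail x (m ↑ʳ i)) (λ i → tail y (m ↑ʳ i)))))

  dot-ℕtoℚ-1≡sumℕ : (f : Fin n → ℕ) → dot (ℕtoℚ ∘ f) (λ _ → 1ℚ) ≡ ℕtoℚ (sumℕ f)
  dot-ℕtoℚ-1≡sumℕ {zero} f = refl
  dot-ℕtoℚ-1≡sumℕ {suc n} f = begin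
    ℕtoℚ (f zero) * 1ℚ + dot (ℕtoℚ ∘ f ∘ suc) (λ _ → 1ℚ)
      ≡⟨ cong₂ _+_ (*-identityʳ (ℕtoℚ (f zero))) (dot-ℕtoℚ-1≡sumℕ (f ∘ suc)) ⟩
    ℕtoℚ (f zero) + ℕtoℚ (sumℕ (f ∘ suc))
      ≡⟨ ℕtoℚ-homo-+ (f zero) (sumℕ (f ∘ suc)) ⟨
    ℕtoℚ (sumℕ f) ∎
    where open ≡-Reasoning

  dot-mono : (a x y : Vecℚ n) → (∀ i → a i * x i ≤ a i * y i) → dot a x ≤ dot a y
  dot-mono {zero} a x y ax≤ay = ≤-refl
  dot-mono {suc n} a x y ax≤ay = +-mono-≤ (ax≤ay zero) (dot-mono (tail a) (tail x) (tail y) (ax≤ay ∘ suc))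

  dot-mono-< : (a x y : Vecℚ n) → (∀ i → a i * x i ≤ a i * y i) →
    (k : Fin n) → a k * x k < a k * y k → dot a x < dot a y
  dot-mono-< {suc n} a x y ax≤ay zero ax<ay =
    +-mono-<-≤ ax<ay (dot-mono (tail a) (tail x) (tail y) (ax≤ay ∘ suc))
  dot-mono-< {suc n} a x y ax≤ay (suc k) ax<ay =
    +-mono-≤-< (ax≤ay zero) (dot-mono-< (tail a) (tail x) (tail y) (ax≤ay ∘ suc) k ax<ay)

  dot-mono-tight : (a x y : Vecℚ n) → (∀ i → a i * x i ≤ a i * y i) →
    dot a x ≡ dot a y → ∀ i → a i * x i ≡ a i * y i
  dot-mono-tight {suc n} a x y ax≤ay eq i with +-mono-≤-tight (ax≤ay zero) (dot-mono (tail a) (tail x) (tail y) (ax≤ay ∘ suc)) eq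
  dot-mono-tight {suc n} a x y ax≤ay eq zero | head≡ , _ = head≡
  dot-mono-tight {suc n} a x y ax≤ay eq (suc i) | _ , tail≡ = dot-mono-tight (tail a) (tail x) (tail y) (ax≤ay ∘ suc) tail≡ i

  dot-agree-except : (w x y : Vecℚ n) (k : Fin n) → 0ℚ < w k →
    (∀ i → i ≢ k → x i ≡ y i) → dot w x ≡ dot w y → x k ≡ y k
  dot-agree-except w x y k 0<wk agree wx≡wy = begin
    x k             ≡⟨ solve 2 (λ x y → x := y :+ (x :- y)) refl (x k) (y k) ⟩
    y k + (x k - y k) ≡⟨ cong (y k +_) (*-cancelˡ-≡-pos 0<wk wk*t≡0) ⟩
    y k + 0ℚ        ≡⟨ +-identityʳ (y k) ⟩
    y k             ∎
    where
    open ≡-Reasoning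
    t : ℚ
    t = x k - y k
    x≡y+t*eₖ : ∀ i → x i ≡ y i + t * eIx k i
    x≡y+t*eₖ i with k Fin.≟ i
    ... | yes refl = solve 2 (λ x y → x := y :+ (x :- y) :* con 1ℚ) refl (x k) (y k)
    ... | no k≢i = trans (agree i (k≢i ∘ sym)) (solve 2 (λ y t → y := y :+ t :* con 0ℚ) refl (y i) t)
    wx≡wy+t*wk : dot w x ≡ dot w y + t * w k
    wx≡wy+t*wk = trans (dot-congʳ w x≡y+t*eₖ) (dot-+-*eIx w y t k)
    wk*t≡0 : w k * t ≡ w k * 0ℚ
    wk*t≡0 = begin
      w k * t                         ≡⟨ solve 3 (λ d t w → w :* t := d :+ t :* w :- d) refl (dot w y) t (w k) ⟩
      dot w y + t * w k - dot w y     ≡⟨ cong (_- dot w y) (trans (sym wx≡wy+t*wk) wx≡wy) ⟩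
      dot w y - dot w y               ≡⟨ solve 2 (λ d w → d :- d := w :* con 0ℚ) refl (dot w y) (w k) ⟩
      w k * 0ℚ                        ∎

  eS-∈ : (S : Subset n) {i : Fin n} → i ∈ S → eS S i ≡ 1ℚ
  eS-∈ S {i} i∈S with i ∈? S
  ... | yes _ = refl
  ... | no i∉S = contradiction i∈S i∉S

  eS-∉ : (S : Subset n) {i : Fin n} → i ∉ S → eS S i ≡ 0ℚ
  eS-∉ S {i} i∉S with i ∈? S
  ... | yes i∈S = contradiction i∈S i∉S
  ... | no _ = refl

  dot-eS-mono-⊂ : (a : Vecℚ n) (S T : Subset n) → (∀ i → 0ℚ ≤ a i) →
    (∀ i → i ∈ T → i ∉ S → 0ℚ < a i) → S ⊂ T → dot a (eS S) < dot a (eS T)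
  dot-eS-mono-⊂ a S T 0≤a 0<a (S⊆T , k , k∈T , k∉S) = dot-mono-< a (eS S) (eS T) aeS≤aeT k aeS<aeT
    where
    aeS≤aeT : ∀ i → a i * eS S i ≤ a i * eS T i
    aeS≤aeT i with i ∈? S
    ... | yes i∈S = ≤-reflexive (cong (a i *_) (sym (eS-∈ T (S⊆T i∈S))))
    ... | no i∉S with i ∈? T
    ...   | yes _ = *-monoˡ-≤-nonNeg (a i) {{nonNegative (0≤a i)}} (<⇒≤ (positive⁻¹ 1ℚ))
    ...   | no _ = ≤-refl
    aeS<aeT : a k * eS S k < a k * eS T k
    aeS<aeT = subst₂ (λ s t → a k * s < a k * t) (sym (eS-∉ S k∉S)) (sym (eS-∈ T k∈T))
      (*-monoʳ-<-pos (a k) {{positive (0<a k k∈T k∉S)}} (positive⁻¹ 1ℚ))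

module ExtremePoints where
  open Arithmetic
  open DotProduct
  open import Data.Rational
  open import Data.Rational.Properties
  open import Data.Rational.Solver
  open +-*-Solver using (solve; _:+_; _:*_; _:-_; _:=_; con)
  open import Data.Product using (_×_; proj₁; proj₂)

  private variable
    n : ℕ

  Extreme : (Vecℚ n → Set) → Vecℚ n → Set
  Extreme P v = ∀ (y z : Vecℚ _) (t : ℚ) → P y → P z → 0ℚ < t → t < 1ℚ →
    (∀ i → v i ≡ t * y i + (1ℚ - t) * z i) → ∀ i → y i ≡ z i

  unique-maximiser⇒extreme : (P : Vecℚ n → Set) (c v : Vecℚ n) →
    (∀ x → P x → dot c x ≤ dot c v) →
    (∀ x → P x → dot c x ≡ dot c v → ∀ i → x i ≡ v i) →
    Extreme P v
  unique-maximiser⇒extreme P c v maximal unique y z t Py Pz 0<t t<1 v≡ty+[1-t]z i =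
    trans (unique y Py cy≡cv i) (sym (unique z Pz cz≡cv i))
    where
    0<1-t : 0ℚ < 1ℚ - t
    0<1-t = p<q⇒0<q-p t<1
    split : t * dot c y + (1ℚ - t) * dot c z ≡ t * dot c v + (1ℚ - t) * dot c v
    split = begin
      t * dot c y + (1ℚ - t) * dot c z
        ≡⟨ cong₂ _+_ (dot-*ʳ c y t) (dot-*ʳ c z (1ℚ - t)) ⟨
      dot c (λ i → t * y i) + dot c (λ i → (1ℚ - t) * z i)
        ≡⟨ dot-distribˡ-+ c (λ i → t * y i) (λ i → (1ℚ - t) * z i) ⟨
      dot c (λ i → t * y i + (1ℚ - t) * z i)
        ≡⟨ dot-congʳ c v≡ty+[1-t]z ⟨
      dot c v
        ≡⟨ solve 2 (λ d t → d := t :* d :+ (con 1ℚ :- t) :* d) refl (dot c v) t ⟩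
      t * dot c v + (1ℚ - t) * dot c v ∎
      where open ≡-Reasoning
    tight : t * dot c y ≡ t * dot c v × (1ℚ - t) * dot c z ≡ (1ℚ - t) * dot c v
    tight = +-mono-≤-tight (*-monoˡ-≤-nonNeg t {{nonNegative (<⇒≤ 0<t)}} (maximal y Py))
                            (*-monoˡ-≤-nonNeg (1ℚ - t) {{nonNegative (<⇒≤ 0<1-t)}} (maximal z Pz)) split
    cy≡cv : dot c y ≡ dot c v
    cy≡cv = *-cancelˡ-≡-pos 0<t (proj₁ tight)
    cz≡cv : dot c z ≡ dot c v
    cz≡cv = *-cancelˡ-≡-pos 0<1-t (proj₂ tight)

module Coordinates where
  open import Data.Fin as Fin using (_↑ˡ_; _↑ʳ_; splitAt; join)
  open import Data.Fin.Properties using (join-splitAt; splitAt-↑ˡ; splitAt-↑ʳ)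
  open import Data.Fin.Subset using (inside; outside; _∈_; _∉_)
  open import Data.Vec using (lookup)
  open import Data.Vec.Properties using (lookup∘tabulate; lookup⇒[]=; []=⇒lookup)
  open import Data.Sum using (_⊎_; inj₁; inj₂)
  open import Data.Rational using (_+_; -_; ½)
  open import Function using (_∋_)
  open import Relation.Nullary using (yes; no; contradiction)

  cases-at : ∀ {n} (k : Fin n) (P : Fin n → Set) → P k → (∀ {i} → i ≢ k → P i) → ∀ i → P i
  cases-at k P Pk P≢k i with i Fin.≟ k
  ... | yes refl = Pk
  ... | no i≢k = P≢k i≢k

  data Coordinate (d : ℕ) : Fin (d ℕ.+ 2) → Set where
    b-coord    : (j : Fin d) → Coordinate d (j ↑ˡ 2)
    β-coord    : Coordinate d (d ↑ʳ zero)
    last-coord : Coordinate d (lastIx d)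

  coordinate : ∀ d i → Coordinate d i
  coordinate d i = subst (Coordinate d) (join-splitAt d 2 i) (classify (splitAt d i))
    where
    classify : (s : Fin d ⊎ Fin 2) → Coordinate d (join d 2 s)
    classify (inj₁ j) = b-coord j
    classify (inj₂ zero) = β-coord
    classify (inj₂ (suc zero)) = last-coord

  module _ (d : ℕ) (b : Fin d → ℕ) (β : ℕ) where

    wvec-b : ∀ j → wvec d b β (j ↑ˡ 2) ≡ ℕtoℚ (b j)
    wvec-b j rewrite splitAt-↑ˡ d j 2 = refl

    wvec-β : wvec d b β (d ↑ʳ zero) ≡ - ℕtoℚ β
    wvec-β rewrite splitAt-↑ʳ d 2 zero = refl

    wvec-last : wvec d b β (lastIx d) ≡ ℕtoℚ β + ½
    wvec-last rewrite splitAt-↑ʳ d 2 (suc zero) = refl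

  ↑ˡ-∈-upToD1 : ∀ d (j : Fin d) → j ↑ˡ 2 ∈ upToD1 d
  ↑ˡ-∈-upToD1 d j = lookup⇒[]= (j ↑ˡ 2) (upToD1 d) inside-b
    where
    -- upToD1 d tabulates a function defined by cases on splitAt: unfold the tabulate, then compute splitAt.
    inside-b : lookup (upToD1 d) (j ↑ˡ 2) ≡ inside
    inside-b with (lookup (upToD1 d) (j ↑ˡ 2) ≡ _ ∋ lookup∘tabulate _ (j ↑ˡ 2))
    ... | eq with splitAt d (j ↑ˡ 2) | splitAt-↑ˡ d j 2
    ... | _ | refl = eq

  ↑ʳ-∈-upToD1 : ∀ d → d ↑ʳ zero ∈ upToD1 d
  ↑ʳ-∈-upToD1 d = lookup⇒[]= (d ↑ʳ zero) (upToD1 d) inside-β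
    where
    inside-β : lookup (upToD1 d) (d ↑ʳ zero) ≡ inside
    inside-β with (lookup (upToD1 d) (d ↑ʳ zero) ≡ _ ∋ lookup∘tabulate _ (d ↑ʳ zero))
    ... | eq with splitAt d {2} (d ↑ʳ zero) | splitAt-↑ʳ d 2 zero
    ... | _ | refl = eq

  ∈-upToD1 : ∀ d {i} → i ≢ lastIx d → i ∈ upToD1 d
  ∈-upToD1 d {i} i≢last with coordinate d i
  ... | b-coord j = ↑ˡ-∈-upToD1 d j
  ... | β-coord = ↑ʳ-∈-upToD1 d
  ... | last-coord = contradiction refl i≢last

  lastIx-∉-upToD1 : ∀ d → lastIx d ∉ upToD1 d
  lastIx-∉-upToD1 d last∈ = inside≢outside (trans (sym ([]=⇒lookup last∈)) last-outside)
    where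
    inside≢outside : inside ≢ outside
    inside≢outside ()
    last-outside : lookup (upToD1 d) (lastIx d) ≡ outside
    last-outside with (lookup (upToD1 d) (lastIx d) ≡ _ ∋ lookup∘tabulate _ (lastIx d))
    ... | eq with splitAt d {2} (d ↑ʳ suc zero) | splitAt-↑ʳ d 2 (suc zero)
    ... | _ | refl = eq

module Polytope (d : ℕ) (b : Fin d → ℕ) (k : ℕ) (Σb≡2β : sumℕ b ≡ 2 ℕ.* suc k) where
  open Arithmetic
  open DotProduct
  open ExtremePoints
  open Coordinates
  open import Data.Fin using (_↑ˡ_; _↑ʳ_)
  open import Data.Fin.Subset using (Subset; _∈_; _∉_; _⊂_)
  open import Data.Integer using (+_)
  open import Data.Rational
  open import Data.Rational.Properties
  open import Data.Rational.Solver
  open +-*-Solver using (solve; _:+_; _:*_; _:-_; :-_; _:=_; con)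
  open import Data.Product using (_×_; _,_; proj₁; proj₂)
  open import Function using (_∘_)
  open import Relation.Nullary using (contradiction)
  open import Relation.Nullary.Decidable using (from-yes)

  β : ℕ
  β = suc k

  B ε ι κ : ℚ
  B = ℕtoℚ β
  ε = eps β
  ι = invWlast β
  κ = ε * ι

  0<ε : 0ℚ < ε
  0<ε = positive⁻¹ ε {{normalize-pos 1 (5 ℕ.* β)}}

  0<ι : 0ℚ < ι
  0<ι = positive⁻¹ ι {{normalize-pos 2 (suc (2 ℕ.* β))}}

  0<κ : 0ℚ < κ
  0<κ = positive⁻¹ κ {{pos*pos⇒pos ε {{positive 0<ε}} ι {{positive 0<ι}}}}

  κ*-mono-≤ : ∀ {p q} → p ≤ q → κ * p ≤ κ * q
  κ*-mono-≤ = *-monoˡ-≤-nonNeg κ {{nonNegative (<⇒≤ 0<κ)}}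

  ε*5B≡1 : ε * (ℕtoℚ 5 * B) ≡ 1ℚ
  ε*5B≡1 = trans (cong (ε *_) (sym (ℕtoℚ-homo-* 5 β))) (p/n*n≡p 1 (5 ℕ.* β))

  ι*[B+½]≡1 : ι * (B + ½) ≡ 1ℚ
  ι*[B+½]≡1 = begin
    ι * (B + ½)
      ≡⟨ solve 2 (λ ι B → ι :* (B :+ con ½) := con ½ :* (ι :* (con 1ℚ :+ con (ℕtoℚ 2) :* B))) refl ι B ⟩
    ½ * (ι * (1ℚ + ℕtoℚ 2 * B))
      ≡⟨ cong (λ x → ½ * (ι * x)) (trans (ℕtoℚ-homo-+ 1 (2 ℕ.* β)) (cong (λ x → 1ℚ + x) (ℕtoℚ-homo-* 2 β))) ⟨
    ½ * (ι * ℕtoℚ (suc (2 ℕ.* β)))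
      ≡⟨ cong (½ *_) (p/n*n≡p 2 (suc (2 ℕ.* β))) ⟩
    ½ * ℕtoℚ 2
      ≡⟨⟩
    1ℚ ∎
    where open ≡-Reasoning

  ι≤2 : ι ≤ ℕtoℚ 2
  ι≤2 = begin
    ι                   ≡⟨ solve 1 (λ ι → ι := ι :* con ½ :* con (ℕtoℚ 2)) refl ι ⟩
    ι * ½ * ℕtoℚ 2      ≤⟨ *-monoʳ-≤-nonNeg (ℕtoℚ 2) (*-monoˡ-≤-nonNeg ι {{nonNegative (<⇒≤ 0<ι)}} ½≤B+½) ⟩
    ι * (B + ½) * ℕtoℚ 2 ≡⟨ cong (_* ℕtoℚ 2) ι*[B+½]≡1 ⟩
    1ℚ * ℕtoℚ 2         ≡⟨ *-identityˡ (ℕtoℚ 2) ⟩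
    ℕtoℚ 2              ∎
    where
    open ≤-Reasoning
    ½≤B+½ : ½ ≤ B + ½
    ½≤B+½ = subst (_≤ B + ½) (+-identityˡ ½) (+-monoˡ-≤ ½ (ℕtoℚ-nonNeg β))

  κ*m<1 : ∀ {m} → m ℕ.≤ 2 ℕ.* β → κ * ℕtoℚ m < 1ℚ
  κ*m<1 {m} m≤2β = begin-strict
    κ * ℕtoℚ m                   ≤⟨ κ*-mono-≤ (ℕtoℚ-mono-≤ m≤2β) ⟩
    κ * ℕtoℚ (2 ℕ.* β)           ≡⟨ cong (κ *_) (ℕtoℚ-homo-* 2 β) ⟩
    ε * ι * (ℕtoℚ 2 * B)
      ≡⟨ solve 3 (λ ε ι B → ε :* ι :* (con (ℕtoℚ 2) :* B) := ε :* (con (ℕtoℚ 5) :* B) :* (con ⅖ :* ι)) refl ε ι B ⟩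
    ε * (ℕtoℚ 5 * B) * (⅖ * ι)   ≡⟨ cong (_* (⅖ * ι)) ε*5B≡1 ⟩
    1ℚ * (⅖ * ι)                 ≡⟨ *-identityˡ (⅖ * ι) ⟩
    ⅖ * ι                        ≤⟨ *-monoˡ-≤-nonNeg ⅖ ι≤2 ⟩
    ⅖ * ℕtoℚ 2                   <⟨ from-yes (⅖ * ℕtoℚ 2 <? 1ℚ) ⟩
    1ℚ                           ∎
    where
    open ≤-Reasoning
    ⅖ : ℚ
    ⅖ = + 2 / 5

  w c a : Vecℚ (d ℕ.+ 2)
  w = wvec d b β
  c = cvec d β
  a i = c i - κ * w i

  L : Fin (d ℕ.+ 2)
  L = lastIx d

  U : Subset (d ℕ.+ 2)
  U = upToD1 d

  c-last : c L ≡ ε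
  c-last = begin
    eS U L + ε * eIx L L ≡⟨ cong₂ (λ e f → e + ε * f) (eS-∉ U (lastIx-∉-upToD1 d)) (eIx-diag L) ⟩
    0ℚ + ε * 1ℚ          ≡⟨ solve 1 (λ ε → con 0ℚ :+ ε :* con 1ℚ := ε) refl ε ⟩
    ε                    ∎
    where open ≡-Reasoning

  c-off-last : ∀ {i} → i ≢ L → c i ≡ 1ℚ
  c-off-last {i} i≢L = begin
    eS U i + ε * eIx L i ≡⟨ cong₂ (λ e f → e + ε * f) (eS-∈ U (∈-upToD1 d i≢L)) (eIx-offDiag L i (i≢L ∘ sym)) ⟩
    1ℚ + ε * 0ℚ          ≡⟨ solve 1 (λ ε → con 1ℚ :+ ε :* con 0ℚ := con 1ℚ) refl ε ⟩
    1ℚ                   ∎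
    where open ≡-Reasoning

  a-last : a L ≡ 0ℚ
  a-last = begin
    c L - κ * w L          ≡⟨ cong₂ (λ γ ω → γ - κ * ω) c-last (wvec-last d b β) ⟩
    ε - ε * ι * (B + ½)    ≡⟨ solve 3 (λ ε ι y → ε :- ε :* ι :* y := ε :- ε :* (ι :* y)) refl ε ι (B + ½) ⟩
    ε - ε * (ι * (B + ½))  ≡⟨ cong (λ y → ε - ε * y) ι*[B+½]≡1 ⟩
    ε - ε * 1ℚ             ≡⟨ solve 1 (λ ε → ε :- ε :* con 1ℚ := con 0ℚ) refl ε ⟩
    0ℚ                     ∎
    where open ≡-Reasoning

  κ*w<1 : ∀ {i} → i ≢ L → κ * w i < 1ℚ
  κ*w<1 {i} = by-coordinate (coordinate d i)
    where
    by-coordinate : ∀ {i} → Coordinate d i → i ≢ L → κ * w i < 1ℚ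
    by-coordinate (b-coord j) _ =
      subst (λ ω → κ * ω < 1ℚ) (sym (wvec-b d b β j)) (κ*m<1 (subst (b j ℕ.≤_) Σb≡2β (≤-sumℕ b j)))
    by-coordinate β-coord _ =
      subst (λ ω → κ * ω < 1ℚ) (sym (wvec-β d b β)) (≤-<-trans κ*-B≤0 (positive⁻¹ 1ℚ))
      where
      κ*-B≤0 : κ * - B ≤ 0ℚ
      κ*-B≤0 = subst (κ * - B ≤_) (*-zeroʳ κ) (κ*-mono-≤ (neg-antimono-≤ (ℕtoℚ-nonNeg β)))
    by-coordinate last-coord L≢L = contradiction refl L≢L

  a-pos : ∀ {i} → i ≢ L → 0ℚ < a i
  a-pos {i} i≢L = subst (λ γ → 0ℚ < γ - κ * w i) (sym (c-off-last i≢L)) (p<q⇒0<q-p (κ*w<1 i≢L))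

  a-nonNeg : ∀ i → 0ℚ ≤ a i
  a-nonNeg = cases-at L (λ i → 0ℚ ≤ a i) (≤-reflexive (sym a-last)) (<⇒≤ ∘ a-pos)

  dot-c-split : ∀ x → dot c x ≡ dot a x + κ * dot w x
  dot-c-split x = dot-decompose c w x κ

  -- ptS d b β S is definitionally eS S + height S · eIx L.
  height : Subset (d ℕ.+ 2) → ℚ
  height S = (rhs β - dot w (eS S)) * ι

  ptS-on-hyperplane : ∀ S → dot w (ptS d b β S) ≡ rhs β
  ptS-on-hyperplane S = begin
    dot w (ptS d b β S)                   ≡⟨ dot-+-*eIx w (eS S) (height S) L ⟩
    dot w (eS S) + height S * w L         ≡⟨ cong (λ ω → dot w (eS S) + height S * ω) (wvec-last d b β) ⟩
    dot w (eS S) + (rhs β - dot w (eS S)) * ι * (B + ½)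
      ≡⟨ solve 4 (λ D r ι y → D :+ (r :- D) :* ι :* y := D :+ (r :- D) :* (ι :* y)) refl (dot w (eS S)) (rhs β) ι (B + ½) ⟩
    dot w (eS S) + (rhs β - dot w (eS S)) * (ι * (B + ½))
      ≡⟨ cong (λ y → dot w (eS S) + (rhs β - dot w (eS S)) * y) ι*[B+½]≡1 ⟩
    dot w (eS S) + (rhs β - dot w (eS S)) * 1ℚ
      ≡⟨ solve 2 (λ D r → D :+ (r :- D) :* con 1ℚ := r) refl (dot w (eS S)) (rhs β) ⟩
    rhs β                                 ∎
    where open ≡-Reasoning

  dot-c-ptS : ∀ S → dot c (ptS d b β S) ≡ dot a (eS S) + κ * rhs β
  dot-c-ptS S = begin
    dot c (ptS d b β S)
      ≡⟨ dot-c-split (ptS d b β S) ⟩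
    dot a (ptS d b β S) + κ * dot w (ptS d b β S)
      ≡⟨ cong₂ (λ α ω → α + κ * ω) (dot-+-*eIx a (eS S) (height S) L) (ptS-on-hyperplane S) ⟩
    dot a (eS S) + height S * a L + κ * rhs β
      ≡⟨ cong (λ α → dot a (eS S) + height S * α + κ * rhs β) a-last ⟩
    dot a (eS S) + height S * 0ℚ + κ * rhs β
      ≡⟨ solve 3 (λ A h r → A :+ h :* con 0ℚ :+ r := A :+ r) refl (dot a (eS S)) (height S) (κ * rhs β) ⟩
    dot a (eS S) + κ * rhs β ∎
    where open ≡-Reasoning

  dot-c-ptS-mono-⊂ : ∀ S T → S ⊂ T → L ∉ T → dot c (ptS d b β S) < dot c (ptS d b β T)
  dot-c-ptS-mono-⊂ S T S⊂T L∉T = subst₂ _<_ (sym (dot-c-ptS S)) (sym (dot-c-ptS T))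
    (+-monoˡ-< (κ * rhs β) (dot-eS-mono-⊂ a S T a-nonNeg (λ i i∈T _ → a-pos λ i≡L → L∉T (subst (_∈ T) i≡L i∈T)) S⊂T))

  dot-w-eU : dot w (eS U) ≡ B
  dot-w-eU = begin
    dot w (eS U)
      ≡⟨ dot-++ d w (eS U) ⟩
    dot (w ∘ (_↑ˡ 2)) (eS U ∘ (_↑ˡ 2)) + (w (d ↑ʳ zero) * eS U (d ↑ʳ zero) + (w L * eS U L + 0ℚ))
      ≡⟨ cong₂ (λ σ τ → σ + (τ + (w L * eS U L + 0ℚ))) b-part β-part ⟩
    ℕtoℚ 2 * B + (- B * 1ℚ + (w L * eS U L + 0ℚ))
      ≡⟨ cong (λ e → ℕtoℚ 2 * B + (- B * 1ℚ + (w L * e + 0ℚ))) (eS-∉ U (lastIx-∉-upToD1 d)) ⟩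
    ℕtoℚ 2 * B + (- B * 1ℚ + (w L * 0ℚ + 0ℚ))
      ≡⟨ solve 2 (λ B ω → con (ℕtoℚ 2) :* B :+ (:- B :* con 1ℚ :+ (ω :* con 0ℚ :+ con 0ℚ)) := B) refl B (w L) ⟩
    B ∎
    where
    open ≡-Reasoning
    b-part : dot (w ∘ (_↑ˡ 2)) (eS U ∘ (_↑ˡ 2)) ≡ ℕtoℚ 2 * B
    b-part = begin
      dot (w ∘ (_↑ˡ 2)) (eS U ∘ (_↑ˡ 2)) ≡⟨ dot-congˡ _ (wvec-b d b β) ⟩
      dot (ℕtoℚ ∘ b) (eS U ∘ (_↑ˡ 2))   ≡⟨ dot-congʳ (ℕtoℚ ∘ b) (λ j → eS-∈ U (↑ˡ-∈-upToD1 d j)) ⟩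
      dot (ℕtoℚ ∘ b) (λ _ → 1ℚ)         ≡⟨ dot-ℕtoℚ-1≡sumℕ b ⟩
      ℕtoℚ (sumℕ b)                    ≡⟨ cong ℕtoℚ Σb≡2β ⟩
      ℕtoℚ (2 ℕ.* β)                   ≡⟨ ℕtoℚ-homo-* 2 β ⟩
      ℕtoℚ 2 * B                       ∎
    β-part : w (d ↑ʳ zero) * eS U (d ↑ʳ zero) ≡ - B * 1ℚ
    β-part = cong₂ _*_ (wvec-β d b β) (eS-∈ U (↑ʳ-∈-upToD1 d))

  v : Vecℚ (d ℕ.+ 2)
  v = ptS d b β U

  ¼ : ℚ
  ¼ = + 1 / 4

  height-U : height U ≡ ¼ * ι
  height-U = begin
    (rhs β - dot w (eS U)) * ι ≡⟨ cong (λ D → (rhs β - D) * ι) dot-w-eU ⟩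
    (B + ¼ - B) * ι            ≡⟨ solve 3 (λ B q ι → (B :+ q :- B) :* ι := q :* ι) refl B ¼ ι ⟩
    ¼ * ι                      ∎
    where open ≡-Reasoning

  v-last : v L ≡ ¼ * ι
  v-last = begin
    eS U L + height U * eIx L L ≡⟨ cong₂ (λ e f → e + height U * f) (eS-∉ U (lastIx-∉-upToD1 d)) (eIx-diag L) ⟩
    0ℚ + height U * 1ℚ          ≡⟨ solve 1 (λ h → con 0ℚ :+ h :* con 1ℚ := h) refl (height U) ⟩
    height U                    ≡⟨ height-U ⟩
    ¼ * ι                       ∎
    where open ≡-Reasoning

  v-off-last : ∀ {i} → i ≢ L → v i ≡ 1ℚ
  v-off-last {i} i≢L = begin
    eS U i + height U * eIx L i ≡⟨ cong₂ (λ e f → e + height U * f) (eS-∈ U (∈-upToD1 d i≢L)) (eIx-offDiag L i (i≢L ∘ sym)) ⟩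
    1ℚ + height U * 0ℚ          ≡⟨ solve 1 (λ h → con 1ℚ :+ h :* con 0ℚ := con 1ℚ) refl (height U) ⟩
    1ℚ                          ∎
    where open ≡-Reasoning

  v∈P : InP d b β v
  v∈P = v∈[0,1] , ≤-reflexive (ptS-on-hyperplane U)
    where
    v∈[0,1] : ∀ i → 0ℚ ≤ v i × v i ≤ 1ℚ
    v∈[0,1] = cases-at L (λ i → 0ℚ ≤ v i × v i ≤ 1ℚ)
      (subst (λ y → 0ℚ ≤ y × y ≤ 1ℚ) (sym v-last)
        ( ≤-trans (≤-reflexive (sym (*-zeroʳ ¼))) (*-monoˡ-≤-nonNeg ¼ (<⇒≤ 0<ι))
        , ≤-trans (*-monoˡ-≤-nonNeg ¼ ι≤2) (from-yes (¼ * ℕtoℚ 2 ≤? 1ℚ))))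
      (λ i≢L → subst (λ y → 0ℚ ≤ y × y ≤ 1ℚ) (sym (v-off-last i≢L)) (<⇒≤ (positive⁻¹ 1ℚ) , ≤-refl))

  a*x≤a*v : ∀ x → InP d b β x → ∀ i → a i * x i ≤ a i * v i
  a*x≤a*v x x∈P = cases-at L (λ i → a i * x i ≤ a i * v i)
    (subst (λ α → α * x L ≤ α * v L) (sym a-last) (≤-reflexive (trans (*-zeroˡ (x L)) (sym (*-zeroˡ (v L))))))
    (λ {i} i≢L → subst (λ y → a i * x i ≤ a i * y) (sym (v-off-last i≢L))
                   (*-monoˡ-≤-nonNeg (a i) {{nonNegative (a-nonNeg i)}} (proj₂ (proj₁ x∈P i))))

  dot-c-v : dot c v ≡ dot a v + κ * rhs β
  dot-c-v = trans (dot-c-split v) (cong (λ ω → dot a v + κ * ω) (ptS-on-hyperplane U))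

  v-maximal : ∀ x → InP d b β x → dot c x ≤ dot c v
  v-maximal x x∈P = begin
    dot c x               ≡⟨ dot-c-split x ⟩
    dot a x + κ * dot w x ≤⟨ +-mono-≤ (dot-mono a x v (a*x≤a*v x x∈P)) (κ*-mono-≤ (proj₂ x∈P)) ⟩
    dot a v + κ * rhs β   ≡⟨ dot-c-v ⟨
    dot c v               ∎
    where open ≤-Reasoning

  0<w-last : 0ℚ < w L
  0<w-last = subst (0ℚ <_) (sym (wvec-last d b β)) (+-mono-≤-< (ℕtoℚ-nonNeg β) (positive⁻¹ ½))

  v-unique : ∀ x → InP d b β x → dot c x ≡ dot c v → ∀ i → x i ≡ v i
  v-unique x x∈P cx≡cv = cases-at L (λ i → x i ≡ v i) x-last x-off-last
    where
    tight : dot a x ≡ dot a v × κ * dot w x ≡ κ * rhs β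
    tight = +-mono-≤-tight (dot-mono a x v (a*x≤a*v x x∈P)) (κ*-mono-≤ (proj₂ x∈P))
              (trans (sym (dot-c-split x)) (trans cx≡cv dot-c-v))
    x-off-last : ∀ {i} → i ≢ L → x i ≡ v i
    x-off-last {i} i≢L = *-cancelˡ-≡-pos (a-pos i≢L) (dot-mono-tight a x v (a*x≤a*v x x∈P) (proj₁ tight) i)
    x-last : x L ≡ v L
    x-last = dot-agree-except w x v L 0<w-last (λ _ → x-off-last)
               (trans (*-cancelˡ-≡-pos 0<κ (proj₂ tight)) (sym (ptS-on-hyperplane U)))

  v-vertex : IsVertex d b β v
  v-vertex = v∈P , unique-maximiser⇒extreme (InP d b β) c v v-maximal v-unique

open import Data.Nat using (ℕ; NonZero; _*_)
open import Data.Rational using (_≤_; _<_)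
open import Data.Fin using (Fin)
open import Data.Fin.Subset using (Subset; _⊂_; _∉_)
open import Data.Product using (_×_; _,_)
open import Relation.Binary.PropositionalEquality using (_≡_)

lemma2p5 : (d : ℕ) (b : Fin d → ℕ) (β : ℕ) .{{_ : NonZero β}} →
    (∀ i → 0 Data.Nat.< b i) → sumℕ b ≡ 2 * β →
    -- (1) ([d+1], d+2) is a vertex and the unique maximizer of c^T x over P_b
    (IsVertex d b β (ptS d b β (upToD1 d))
      × (∀ x → InP d b β x → dot (cvec d β) x ≤ dot (cvec d β) (ptS d b β (upToD1 d)))
      × (∀ x → InP d b β x → dot (cvec d β) x ≡ dot (cvec d β) (ptS d b β (upToD1 d)) →
           ∀ i → x i ≡ ptS d b β (upToD1 d) i))
    ×
    -- (2) S ⊊ T ⊆ [d+1], both (S,d+2),(T,d+2) vertices ⇒ c^T(S,d+2) < c^T(T,d+2)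
    (∀ (S T : Subset (d Data.Nat.+ 2)) → S ⊂ T → lastIx d ∉ T →
       IsVertex d b β (ptS d b β S) → IsVertex d b β (ptS d b β T) →
       dot (cvec d β) (ptS d b β S) < dot (cvec d β) (ptS d b β T))
lemma2p5 d b (suc k) _ Σb≡2β =
  (v-vertex , v-maximal , v-unique) , λ S T S⊂T L∉T _ _ → dot-c-ptS-mono-⊂ S T S⊂T L∉T
  where open Polytope d b k Σb≡2β
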